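{- Let $(M,\eta^M,(-)^\dagger_M)$ be a monad on $\mathbf{Type}$ and suppose given a weak Mendler-style $M$-algebra on a universe $\mathbf{U}$, with extension operation $P\mapsto P^\star$, action $h\mapsto[h]^\star$ and witnesses $\mathsf{i}_P$, $\mathsf{j}_{Q,f}$. Then the following data form a monad $(T,\eta,(-)^\dagger)$ (in Kleisli triple form) on $\mathbf{Cont}(\mathbf{U})$: $T(A\triangleleft P)=MA\triangleleft P^\star$; $\eta_{A\triangleleft P}=\eta^M_A\triangleleft(\lambda\{a\}.\,\mathsf{i}_P\{a\})$; and for a container morphism $f\triangleleft g:A\triangleleft P\to T(B\triangleleft Q)$ (so $f:A\to MB$, $g:\prod_{\{a:A\}}(Q^\star(f\,a)\to P\,a)$), $(f\triangleleft g)^\dagger=f^\dagger_M\triangleleft\big(\lambda\{m\}.\,[g]^\star\{m\}\circ\mathsf{j}_{Q,f}\{m\}\big):T(A\triangleleft P)\to T(B\triangleleft Q)$.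
   Context: Work in extensional Martin-Löf type theory. For a universe $\mathbf{U}$, $\mathbf{Cont}(\mathbf{U})$ is the category of containers $A\triangleleft P$ ($A$ a type, $P:A\to\mathbf{U}$) with morphisms $f\triangleleft g:A\triangleleft P\to B\triangleleft Q$ given by $f:A\to B$, $g:\prod_{\{a:A\}}(Q(f\,a)\to P\,a)$, composition $(k\triangleleft l)\circ(f\triangleleft g)=(k\circ f)\triangleleft(\lambda\{a\}.\,g\{a\}\circ l\{f\,a\})$, identities pairs of identities. A monad in Kleisli-triple form on a category consists of an object map $T$, morphisms $\eta_A:A\to TA$ and an extension $f\mapsto f^\dagger:TA\to TB$ for $f:A\to TB$, with $\eta_A^\dagger=\mathrm{id}$, $f^\dagger\circ\eta_A=f$, $(g^\dagger\circ f)^\dagger=g^\dagger\circ f^\dagger$. A weak Mendler-style $M$-algebra on $\mathbf{U}$ consists of: (i) an extension operation sending every $P:A\to\mathbf{U}$ to $P^\star:MA\to\mathbf{U}$; (ii) an action sending every $h:\prod_{\{a:A\}}(P\,a\to Q\,a)$ (with $P,Q:A\to\mathbf{U}$) to $[h]^\star:\prod_{\{m:MA\}}(P^\star m\to Q^\star m)$; (iii) maps $\mathsf{i}_P:\prod_{\{a:A\}}(P^\star(\eta^M_A\,a)\to P\,a)$ for all $P:A\to\mathbf{U}$; (iv) maps $\mathsf{j}_{Q,f}:\prod_{\{m:MA\}}(Q^\star(f^\dagger_M\,m)\to(Q^\star\circ f)^\star\,m)$ for all $Q:B\to\mathbf{U}$, $f:A\to MB$; such that, for all $P,P':A\to\mathbf{U}$,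 $Q,Q':B\to\mathbf{U}$, $R:C\to\mathbf{U}$, $h:\prod_{\{a\}}(P\,a\to P'\,a)$, $h'$ a family map from $P'$ to a further family, $k:\prod_{\{b\}}(Q\,b\to Q'\,b)$, $f:A\to MB$, $g:B\to MC$, $a:A$, $m:MA$: (1) functoriality: $[\lambda\{a\}.\,\mathrm{id}_{P a}]^\star=\mathrm{id}$ and $[\lambda\{a\}.\,h'\{a\}\circ h\{a\}]^\star=[h']^\star\circ[h]^\star$; (2) naturality: $h\circ\mathsf{i}_P=\mathsf{i}_{P'}\circ[h]^\star$ at $\eta^M_A a$, and $[\lambda\{a\}.\,[k]^\star\{f\,a\}]^\star\circ\mathsf{j}_{Q,f}=\mathsf{j}_{Q',f}\circ[k]^\star$ at $f^\dagger_M m$; (3) coherence: $\mathsf{i}_{Q^\star\circ f}\circ\mathsf{j}_{Q,f}=\mathrm{id}$ on $Q^\star(f^\dagger_M(\eta^M_A a))=Q^\star(f\,a)$; $[\mathsf{i}_P]^\star\circ\mathsf{j}_{P,\eta^M_A}=\mathrm{id}$ on $P^\star((\eta^M_A)^\dagger_M m)=P^\star m$; and $\mathsf{j}_{R^\star\circ g,f}\circ\mathsf{j}_{R,g}=[\lambda\{a\}.\,\mathsf{j}_{R,g}\{f\,a\}]^\star\circ\mathsf{j}_{R,g^\dagger_M\circ f}$ as maps $R^\star((g^\dagger_M\circ f)^\dagger_M m)=R^\star(g^\dagger_M(f^\dagger_M m))\to((R^\star\circ g)^\star\circ f)^\star m$ (the equalities of types are instances of the monad laws of $M$). -}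

module Defs where

open import Level using (Level; _⊔_; suc)
open import Function using (_∘_; id)
open import Data.Product using (Σ; _,_; _×_)
open import Relation.Binary.PropositionalEquality using (_≡_; subst; sym)

-- Extensional MLTT is modelled by stating all equations between functions
-- pointwise (and equations between dependent components up to transport).

record KMonad (a : Level) : Set (suc a) where
  field
    M    : Set a → Set a
    η    : {A : Set a} → A → M A
    ext  : {A B : Set a} → (A → M B) → M A → M B
    ext-η   : {A : Set a} (m : M A) → ext η m ≡ m
    ext-β   : {A B : Set a} (f : A → M B) (x : A) → ext f (η x) ≡ f x
    ext-ext : {A B C : Set a} (f : A → M B) (g : B → M C) (m : M A) →
              ext (ext g ∘ f) m ≡ ext g (ext f m)

FamMap : {a u : Level} {A : Set a} → (A → Set u) → (A → Set u) → Set (a ⊔ u)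
FamMap {A = A} P Q = {x : A} → P x → Q x

record WeakMendlerAlg {a : Level} (Mo : KMonad a) (u : Level) : Set (suc a ⊔ suc u) where
  open KMonad Mo
  field
    star  : {A : Set a} → (A → Set u) → M A → Set u
    [_]⋆  : {A : Set a} {P Q : A → Set u} → FamMap P Q → FamMap (star P) (star Q)
    i     : {A : Set a} (P : A → Set u) → {x : A} → (star P) (η x) → P x
    j     : {A B : Set a} (Q : B → Set u) (f : A → M B) →
            {m : M A} → (star Q) (ext f m) → star (star Q ∘ f) m
    fun-id   : {A : Set a} {P : A → Set u} {m : M A} (x : (star P) m) →
               [ (λ {y} → id {A = P y}) ]⋆ x ≡ x
    fun-comp : {A : Set a} {P P' P'' : A → Set u}
               (h : FamMap P P') (h' : FamMap P' P'') {m : M A} (x : (star P) m) →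
               [ (λ {y} → h' {y} ∘ h {y}) ]⋆ x ≡ [ h' ]⋆ ([ h ]⋆ x)
    nat-i : {A : Set a} {P P' : A → Set u} (h : FamMap P P') (x : A)
            (p : (star P) (η x)) → h (i P p) ≡ i P' ([ h ]⋆ p)
    nat-j : {A B : Set a} {Q Q' : B → Set u} (k : FamMap Q Q') (f : A → M B)
            (m : M A) (q : (star Q) (ext f m)) →
            [ (λ {y} → [ k ]⋆ {f y}) ]⋆ (j Q f q) ≡ j Q' f ([ k ]⋆ q)
    -- (3) coherence (type equalities are the monad laws of M)
    coh-β   : {A B : Set a} (Q : B → Set u) (f : A → M B) (x : A)
              (q : (star Q) (ext f (η x))) →
              i (star Q ∘ f) (j Q f q) ≡ subst (star Q) (ext-β f x) q
    coh-η   : {A : Set a} (P : A → Set u) (m : M A) (p : (star P) (ext η m)) →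
              [ (λ {y} → i P {y}) ]⋆ (j P η p) ≡ subst (star P) (ext-η m) p
    coh-ext : {A B C : Set a} (R : C → Set u) (f : A → M B) (g : B → M C)
              (m : M A) (r : (star R) (ext g (ext f m))) →
              j (star R ∘ g) f (j R g r)
                ≡ [ (λ {y} → j R g {f y}) ]⋆
                    (j R (ext g ∘ f) (subst (star R) (sym (ext-ext f g m)) r))

record Cont (a u : Level) : Set (suc a ⊔ suc u) where
  constructor _◁_
  field
    Sh  : Set a
    Pos : Sh → Set u
open Cont public

record ContHom {a u : Level} (C D : Cont a u) : Set (a ⊔ u) where
  constructor _◁ₘ_
  field
    shf  : Sh C → Sh D
    posf : {s : Sh C} → Pos D (shf s) → Pos C s
open ContHom public

idC : {a u : Level} {C : Cont a u} → ContHom C C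
idC = id ◁ₘ id

_∘C_ : {a u : Level} {C D E : Cont a u} → ContHom D E → ContHom C D → ContHom C E
(k ◁ₘ l) ∘C (f ◁ₘ g) = (k ∘ f) ◁ₘ (λ {s} → g {s} ∘ l {f s})

_≈C_ : {a u : Level} {C D : Cont a u} → ContHom C D → ContHom C D → Set (a ⊔ u)
_≈C_ {C = C} {D = D} (f ◁ₘ g) (f' ◁ₘ g') =
  Σ ((s : Sh C) → f s ≡ f' s) λ e →
    (s : Sh C) (q : Pos D (f s)) → g {s} q ≡ g' {s} (subst (Pos D) (e s) q)

IsKleisliTripleC : {a u : Level}
  (T : Cont a u → Cont a u)
  (ηC : (C : Cont a u) → ContHom C (T C))
  (ext : {C D : Cont a u} → ContHom C (T D) → ContHom (T C) (T D)) →
  Set (suc a ⊔ suc u)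
IsKleisliTripleC {a} {u} T ηC ext =
  ((C : Cont a u) → ext (ηC C) ≈C idC)
  × ({C D : Cont a u} (φ : ContHom C (T D)) → (ext φ ∘C ηC C) ≈C φ)
  × ({C D E : Cont a u} (φ : ContHom C (T D)) (ψ : ContHom D (T E)) →
       ext (ext ψ ∘C φ) ≈C (ext ψ ∘C ext φ))

module Construction {a u : Level} (Mo : KMonad a) (Alg : WeakMendlerAlg Mo u) where
  open KMonad Mo
  open WeakMendlerAlg Alg

  T : Cont a u → Cont a u
  T (A ◁ P) = M A ◁ (star P)

  ηT : (C : Cont a u) → ContHom C (T C)
  ηT (A ◁ P) = η ◁ₘ (λ {x} → i P {x})

  extT : {C D : Cont a u} → ContHom C (T D) → ContHom (T C) (T D)
  extT {A ◁ P} {B ◁ Q} (f ◁ₘ g) = ext f ◁ₘ (λ {m} → [ g ]⋆ {m} ∘ j Q f {m})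

-- On shapes each Kleisli law for T is the corresponding monad law of M.  On
-- positions it is the corresponding coherence axiom of the algebra (coh-η,
-- coh-β, coh-ext), once the action [ g ]⋆ of the Kleisli map has been moved
-- past i or j by naturality and the composite actions have been split by
-- functoriality.
module Submission where

open import Defs
open import Level using (Level)
open import Function using (_∘_)
open import Data.Product using (_,_)
open import Relation.Binary.PropositionalEquality

module KleisliLaws {a u : Level} (Mo : KMonad a) (Alg : WeakMendlerAlg Mo u) where
  open KMonad Mo
  open WeakMendlerAlg Alg
  open Construction Mo Alg
  open ≡-Reasoning

  []⋆-∘₃ : {A : Set a} {P P′ P″ P‴ : A → Set u}
           (h : FamMap P P′) (h′ : FamMap P′ P″) (h″ : FamMap P″ P‴)
           {m : M A} (x : star P m) →
           [ (λ {y} → h″ {y} ∘ h′ {y} ∘ h {y}) ]⋆ x ≡ [ h″ ]⋆ ([ h′ ]⋆ ([ h ]⋆ x))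
  []⋆-∘₃ h h′ h″ x = begin
    [ (λ {y} → h″ {y} ∘ h′ {y} ∘ h {y}) ]⋆ x    ≡⟨ fun-comp h (λ {y} → h″ {y} ∘ h′ {y}) x ⟩
    [ (λ {y} → h″ {y} ∘ h′ {y}) ]⋆ ([ h ]⋆ x)   ≡⟨ fun-comp h′ h″ ([ h ]⋆ x) ⟩
    [ h″ ]⋆ ([ h′ ]⋆ ([ h ]⋆ x))                ∎

  j-ext : {A B C : Set a} (R : C → Set u) (f : A → M B) (g : B → M C)
          (m : M A) (r : star R (ext (ext g ∘ f) m)) →
          [ (λ {x} → j R g {f x}) ]⋆ (j R (ext g ∘ f) r)
            ≡ j (star R ∘ g) f (j R g (subst (star R) (ext-ext f g m) r))
  j-ext R f g m r = begin
    [ (λ {x} → j R g {f x}) ]⋆ (j R (ext g ∘ f) r)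
      ≡⟨ cong ([ (λ {x} → j R g {f x}) ]⋆ ∘ j R (ext g ∘ f)) (sym (subst-sym-subst e)) ⟩
    [ (λ {x} → j R g {f x}) ]⋆ (j R (ext g ∘ f) (subst (star R) (sym e) (subst (star R) e r)))
      ≡⟨ sym (coh-ext R f g m (subst (star R) e r)) ⟩
    j (star R ∘ g) f (j R g (subst (star R) e r))
      ∎
    where e = ext-ext f g m

  extT-ηT : (C : Cont a u) → extT (ηT C) ≈C idC
  extT-ηT (A ◁ P) = ext-η , coh-η P

  extT-∘C-ηT : {C D : Cont a u} (φ : ContHom C (T D)) → (extT φ ∘C ηT C) ≈C φ
  extT-∘C-ηT {A ◁ P} {B ◁ Q} (f ◁ₘ g) = ext-β f , λ x q → begin
    i P ([ g ]⋆ (j Q f q))                    ≡⟨ sym (nat-i g x (j Q f q)) ⟩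
    g (i (star Q ∘ f) (j Q f q))              ≡⟨ cong g (coh-β Q f x q) ⟩
    g (subst (star Q) (ext-β f x) q)          ∎

  extT-assoc : {C D E : Cont a u} (φ : ContHom C (T D)) (ψ : ContHom D (T E)) →
               extT (extT ψ ∘C φ) ≈C (extT ψ ∘C extT φ)
  extT-assoc {A ◁ P} {B ◁ Q} {C ◁ R} (f ◁ₘ g) (k ◁ₘ l) = ext-ext f k , λ m r →
    let r′ = subst (star R) (ext-ext f k m) r in begin
    [ (λ {x} → g {x} ∘ [ l ]⋆ {f x} ∘ j R k {f x}) ]⋆ (j R (ext k ∘ f) r)
      ≡⟨ []⋆-∘₃ (λ {x} → j R k {f x}) (λ {x} → [ l ]⋆ {f x}) g _ ⟩
    [ g ]⋆ ([ (λ {x} → [ l ]⋆ {f x}) ]⋆ ([ (λ {x} → j R k {f x}) ]⋆ (j R (ext k ∘ f) r)))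
      ≡⟨ cong ([ g ]⋆ ∘ [ (λ {x} → [ l ]⋆ {f x}) ]⋆) (j-ext R f k m r) ⟩
    [ g ]⋆ ([ (λ {x} → [ l ]⋆ {f x}) ]⋆ (j (star R ∘ k) f (j R k r′)))
      ≡⟨ cong [ g ]⋆ (nat-j l f m (j R k r′)) ⟩
    [ g ]⋆ (j Q f ([ l ]⋆ (j R k r′)))
      ∎

theorem9 : {a u : Level} (Mo : KMonad a) (Alg : WeakMendlerAlg Mo u) →
    IsKleisliTripleC (Construction.T Mo Alg) (Construction.ηT Mo Alg) (Construction.extT Mo Alg)
theorem9 Mo Alg = extT-ηT , extT-∘C-ηT , extT-assoc
  where open KleisliLaws Mo Alg
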